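{- Let $\mathbf{D}=(d_{i,j})\in\mathbb{N}^{k\times n}$ be a tree degree matrix without common leaves, and assume $n\ge 6k-5$. Then there is at most one column $j$ whose column sum $\sum_{i=1}^k d_{i,j}$ is at least $\frac{2n}{3}$.
   Context: A tree degree sequence $d_1,\dots,d_n$ is a sequence of positive integers with $\sum_j d_j=2n-2$. A $k\times n$ matrix is a tree degree matrix if each row is a tree degree sequence; it has no common leaves if each column contains at most one entry equal to $1$. The degree of a vertex (column) is its column sum. -}

module Defs where

open import Data.Nat using (ℕ; zero; suc; _+_; _*_; _∸_; _≤_)
open import Data.Fin using (Fin; zero; suc)
open import Relation.Binary.PropositionalEquality using (_≡_; _≢_)

∑ : (n : ℕ) → (Fin n → ℕ) → ℕ
∑ zero    f = 0
∑ (suc n) f = f zero + ∑ n (λ i → f (suc i))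

IsTreeDegreeSeq : (n : ℕ) → (Fin n → ℕ) → Set
IsTreeDegreeSeq n d = (∀ j → 1 ≤ d j) × (∑ n d ≡ 2 * n ∸ 2)
  where open import Data.Product using (_×_)

IsTreeDegreeMatrix : (k n : ℕ) → (Fin k → Fin n → ℕ) → Set
IsTreeDegreeMatrix k n D = ∀ i → IsTreeDegreeSeq n (D i)

NoCommonLeaves : (k n : ℕ) → (Fin k → Fin n → ℕ) → Set
NoCommonLeaves k n D = ∀ (j : Fin n) (i i' : Fin k) → D i j ≡ 1 → D i' j ≡ 1 → i ≡ i'

colSum : (k n : ℕ) → (Fin k → Fin n → ℕ) → Fin n → ℕ
colSum k n D j = ∑ k (λ i → D i j)

-- In a row d, the n - 2 entries outside two columns j ≠ j' are positive and sum to
-- 2n - 2 - d_j - d_j'; each non-leaf entry is at least 2, so d_j + d_j' ≤ 2 + (number of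
-- leaves outside j, j'). Summing over the k rows, and using that without common leaves each
-- of the n - 2 other columns holds at most one leaf, two distinct vertices have degrees
-- summing to at most 2k + n - 2. Two vertices of degree ≥ 2n/3 would give 4n/3 ≤ 2k + n - 2,
-- that is n ≤ 6k - 6.
module Submission where

open import Defs
open import Data.Nat using (ℕ; zero; suc; _+_; _*_; _∸_; _≤_; z≤n; s≤s)
open import Data.Nat.Properties
open import Data.Nat.Solver using (module +-*-Solver)
open import Data.Fin using (Fin; zero; suc; punchIn; punchOut) renaming (_≟_ to _≟ᶠ_)
open import Data.Fin.Properties using (punchIn-punchOut) renaming (suc-injective to fsuc-injective; 0≢1+n to fzero≢fsuc)
open import Data.Product using (_,_)
open import Data.Empty using (⊥; ⊥-elim)
open import Function using (_∘_)
open import Relation.Nullary using (yes; no; contradiction)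
open import Relation.Binary.PropositionalEquality
open import Algebra.Properties.CommutativeSemigroup +-commutativeSemigroup
  using (interchange; x∙yz≈y∙xz)
open +-*-Solver

∑-mono-≤ : ∀ n {f g : Fin n → ℕ} → (∀ c → f c ≤ g c) → ∑ n f ≤ ∑ n g
∑-mono-≤ zero    f≤g = z≤n
∑-mono-≤ (suc n) f≤g = +-mono-≤ (f≤g zero) (∑-mono-≤ n (f≤g ∘ suc))

∑-const : ∀ n c → ∑ n (λ _ → c) ≡ n * c
∑-const zero    c = refl
∑-const (suc n) c = cong (c +_) (∑-const n c)

∑-distrib-+ : ∀ n (f g : Fin n → ℕ) → ∑ n (λ c → f c + g c) ≡ ∑ n f + ∑ n g
∑-distrib-+ zero    f g = refl
∑-distrib-+ (suc n) f g = trans (cong (f zero + g zero +_) (∑-distrib-+ n (f ∘ suc) (g ∘ suc)))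
  (interchange (f zero) (g zero) (∑ n (f ∘ suc)) (∑ n (g ∘ suc)))

∑-comm : ∀ k n (F : Fin k → Fin n → ℕ) →
  ∑ k (λ i → ∑ n (F i)) ≡ ∑ n (λ c → ∑ k (λ i → F i c))
∑-comm zero    n F = sym (trans (∑-const n 0) (*-zeroʳ n))
∑-comm (suc k) n F = trans (cong (∑ n (F zero) +_) (∑-comm k n (F ∘ suc)))
  (sym (∑-distrib-+ n (F zero) (λ c → ∑ k (λ i → F (suc i) c))))

∑-punchIn : ∀ n (f : Fin (suc n) → ℕ) j → ∑ (suc n) f ≡ f j + ∑ n (f ∘ punchIn j)
∑-punchIn n       f zero    = refl
∑-punchIn (suc n) f (suc j) = trans (cong (f zero +_) (∑-punchIn n (f ∘ suc) j))
  (x∙yz≈y∙xz (f zero) (f (suc j)) _)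

others : ∀ {m} → Fin (suc (suc m)) → Fin (suc m) → Fin m → Fin (suc (suc m))
others j i = punchIn j ∘ punchIn i

∑-pair : ∀ m (f : Fin (suc (suc m)) → ℕ) j i →
  ∑ (suc (suc m)) f ≡ f j + f (punchIn j i) + ∑ m (f ∘ others j i)
∑-pair m f j i = trans (∑-punchIn (suc m) f j) (trans
  (cong (f j +_) (∑-punchIn m (f ∘ punchIn j) i))
  (sym (+-assoc (f j) (f (punchIn j i)) _)))

leaf : ℕ → ℕ
leaf 1 = 1
leaf _ = 0

2≤x+leaf[x] : ∀ {x} → 1 ≤ x → 2 ≤ x + leaf x
2≤x+leaf[x] {suc zero}    _ = ≤-refl
2≤x+leaf[x] {suc (suc x)} _ = s≤s (s≤s z≤n)

leaf≡0 : ∀ {x} → x ≢ 1 → leaf x ≡ 0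
leaf≡0 {zero}          _   = refl
leaf≡0 {suc zero}      x≢1 = contradiction refl x≢1
leaf≡0 {suc (suc x)}   _   = refl

positive-sum+leaves : ∀ m (g : Fin m → ℕ) → (∀ c → 1 ≤ g c) →
  2 * m ≤ ∑ m g + ∑ m (leaf ∘ g)
positive-sum+leaves m g pos = begin
  2 * m                           ≡⟨ *-comm 2 m ⟩
  m * 2                           ≡⟨ ∑-const m 2 ⟨
  ∑ m (λ _ → 2)                   ≤⟨ ∑-mono-≤ m (2≤x+leaf[x] ∘ pos) ⟩
  ∑ m (λ c → g c + leaf (g c))    ≡⟨ ∑-distrib-+ m g (leaf ∘ g) ⟩
  ∑ m g + ∑ m (leaf ∘ g)          ∎
  where open ≤-Reasoning

leaves≤1 : ∀ k (g : Fin k → ℕ) → (∀ i i' → g i ≡ 1 → g i' ≡ 1 → i ≡ i') →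
  ∑ k (leaf ∘ g) ≤ 1
leaves≤1 zero    g unique = z≤n
leaves≤1 (suc k) g unique with g zero ≟ 1
... | yes g₀≡1 = ≤-reflexive (cong₂ _+_ (cong leaf g₀≡1) restNoLeaf)
  where
  restNoLeaf : ∑ k (leaf ∘ g ∘ suc) ≡ 0
  restNoLeaf = n≤0⇒n≡0 (begin
    ∑ k (leaf ∘ g ∘ suc) ≤⟨ ∑-mono-≤ k (λ i → ≤-reflexive (leaf≡0 (λ gᵢ≡1 →
                              fzero≢fsuc (unique zero (suc i) g₀≡1 gᵢ≡1)))) ⟩
    ∑ k (λ _ → 0)         ≡⟨ ∑-const k 0 ⟩
    k * 0                 ≡⟨ *-zeroʳ k ⟩
    0                     ∎)
    where open ≤-Reasoning
... | no g₀≢1 rewrite leaf≡0 g₀≢1 =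
  leaves≤1 k (g ∘ suc) (λ i i' p q → fsuc-injective (unique (suc i) (suc i') p q))

row-pair-bound : ∀ m (d : Fin (suc (suc m)) → ℕ) → IsTreeDegreeSeq (suc (suc m)) d →
  ∀ j i → d j + d (punchIn j i) ≤ 2 + ∑ m (leaf ∘ d ∘ others j i)
row-pair-bound m d (pos , sum≡) j i = +-cancelʳ-≤ (2 * m) (d j + d (punchIn j i)) (2 + L) (begin
  d j + d (punchIn j i) + 2 * m        ≤⟨ +-monoʳ-≤ (d j + d (punchIn j i))
                                            (positive-sum+leaves m (d ∘ others j i) (pos ∘ others j i)) ⟩
  d j + d (punchIn j i) + (R + L)      ≡⟨ +-assoc (d j + d (punchIn j i)) R L ⟨
  d j + d (punchIn j i) + R + L        ≡⟨ cong (_+ L) (∑-pair m d j i) ⟨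
  ∑ (suc (suc m)) d + L                ≡⟨ cong (_+ L) sum≡ ⟩
  -- 2 * (2 + m) ∸ 2 computes to m + (2 + (m + 0)), the left side handed to the solver.
  2 * suc (suc m) ∸ 2 + L              ≡⟨ solve 2 (λ m L → m :+ (con 2 :+ (m :+ con 0)) :+ L
                                                        := con 2 :+ L :+ con 2 :* m) refl m L ⟩
  2 + L + 2 * m                        ∎)
  where
  open ≤-Reasoning
  R L : ℕ
  R = ∑ m (d ∘ others j i)
  L = ∑ m (leaf ∘ d ∘ others j i)

colSum-pair-bound : ∀ k m (D : Fin k → Fin (suc (suc m)) → ℕ) →
  IsTreeDegreeMatrix k (suc (suc m)) D → NoCommonLeaves k (suc (suc m)) D →
  ∀ j i → colSum k (suc (suc m)) D j + colSum k (suc (suc m)) D (punchIn j i) ≤ 2 * k + m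
colSum-pair-bound k m D tdm ncl j i = begin
  colSum k n D j + colSum k n D (punchIn j i)        ≡⟨ ∑-distrib-+ k _ _ ⟨
  ∑ k (λ r → D r j + D r (punchIn j i))              ≤⟨ ∑-mono-≤ k (λ r → row-pair-bound m (D r) (tdm r) j i) ⟩
  ∑ k (λ r → 2 + ∑ m (Leaves r))                     ≡⟨ ∑-distrib-+ k _ _ ⟩
  ∑ k (λ _ → 2) + ∑ k (λ r → ∑ m (Leaves r))         ≡⟨ cong₂ _+_ (trans (∑-const k 2) (*-comm k 2))
                                                                   (∑-comm k m Leaves) ⟩
  2 * k + ∑ m (λ c → ∑ k (λ r → Leaves r c))         ≤⟨ +-monoʳ-≤ (2 * k) (∑-mono-≤ m (λ c →
                                                          leaves≤1 k (λ r → D r (others j i c)) (ncl (others j i c)))) ⟩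
  2 * k + ∑ m (λ _ → 1)                              ≡⟨ cong (2 * k +_) (trans (∑-const m 1) (*-identityʳ m)) ⟩
  2 * k + m                                          ∎
  where
  open ≤-Reasoning
  n : ℕ
  n = suc (suc m)
  Leaves : Fin k → Fin m → ℕ
  Leaves r = leaf ∘ D r ∘ others j i

colSum-distinct-bound : ∀ k n (D : Fin k → Fin n → ℕ) →
  IsTreeDegreeMatrix k n D → NoCommonLeaves k n D → ∀ {j j'} → j ≢ j' →
  colSum k n D j + colSum k n D j' + 2 ≤ 2 * k + n
colSum-distinct-bound k (suc zero) D tdm ncl {zero} {zero} j≢j' = contradiction refl j≢j'
colSum-distinct-bound k (suc (suc m)) D tdm ncl {j} j≢j' =
  subst (λ j' → colSum k (suc (suc m)) D j + colSum k (suc (suc m)) D j' + 2 ≤ 2 * k + suc (suc m))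
    (punchIn-punchOut j≢j')
    (begin
      colSum k (suc (suc m)) D j + colSum k (suc (suc m)) D (punchIn j i) + 2
                      ≤⟨ +-monoˡ-≤ 2 (colSum-pair-bound k m D tdm ncl j i) ⟩
      2 * k + m + 2   ≡⟨ solve 2 (λ k m → con 2 :* k :+ m :+ con 2 := con 2 :* k :+ (con 2 :+ m)) refl k m ⟩
      2 * k + suc (suc m) ∎)
  where
  open ≤-Reasoning
  i : Fin (suc m)
  i = punchOut j≢j'

two-heavy-columns-impossible : ∀ k n A B → 2 * n ≤ 3 * A → 2 * n ≤ 3 * B →
  A + B + 2 ≤ 2 * k + n → 6 * k ≤ n + 5 → ⊥
two-heavy-columns-impossible k n A B 2n≤3A 2n≤3B A+B+2≤ 6k≤ = 1+n≰n (begin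
  suc (4 * n + 5)        ≡⟨ solve 1 (λ n → con 1 :+ (con 4 :* n :+ con 5) := con 2 :* n :+ con 2 :* n :+ con 6) refl n ⟩
  2 * n + 2 * n + 6      ≤⟨ +-monoˡ-≤ 6 (+-mono-≤ 2n≤3A 2n≤3B) ⟩
  3 * A + 3 * B + 6      ≡⟨ solve 2 (λ A B → con 3 :* A :+ con 3 :* B :+ con 6 := con 3 :* (A :+ B :+ con 2)) refl A B ⟩
  3 * (A + B + 2)        ≤⟨ *-monoʳ-≤ 3 A+B+2≤ ⟩
  3 * (2 * k + n)        ≡⟨ solve 2 (λ k n → con 3 :* (con 2 :* k :+ n) := con 6 :* k :+ con 3 :* n) refl k n ⟩
  6 * k + 3 * n          ≤⟨ +-monoˡ-≤ (3 * n) 6k≤ ⟩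
  n + 5 + 3 * n          ≡⟨ solve 1 (λ n → n :+ con 5 :+ con 3 :* n := con 4 :* n :+ con 5) refl n ⟩
  4 * n + 5              ∎)
  where open ≤-Reasoning

mainTheorem12 : (k n : ℕ) (D : Fin k → Fin n → ℕ) →
    IsTreeDegreeMatrix k n D → NoCommonLeaves k n D → 6 * k ≤ n + 5 →
    (j j' : Fin n) → 2 * n ≤ 3 * colSum k n D j → 2 * n ≤ 3 * colSum k n D j' → j ≡ j'
mainTheorem12 k n D tdm ncl 6k≤ j j' heavy heavy' with j ≟ᶠ j'
... | yes j≡j' = j≡j'
... | no j≢j'  = ⊥-elim (two-heavy-columns-impossible k n (colSum k n D j) (colSum k n D j') heavy heavy'
                   (colSum-distinct-bound k n D tdm ncl j≢j') 6k≤)
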